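{- Let $\pi:\mathsf{Lit}_A\to\mathbb N[X,\overline X]$ be a model-compatible interpretation and $\phi$ a first-order sentence. Then $\phi$ is $\mathsf{Mod}_\pi$-satisfiable (true in some structure of $\mathsf{Mod}_\pi$) if and only if $\pi[\![\phi]\!]\neq0$, and $\phi$ is $\mathsf{Mod}_\pi$-valid (true in every structure of $\mathsf{Mod}_\pi$) if and only if $\pi[\![\neg\phi]\!]=0$.
   Context: Fix a finite relational vocabulary $\mathscr V$ and finite non-empty $A$; $\mathsf{Facts}_A$ is the set of ground atoms $R(\mathbf a)$, $\mathsf{NegFacts}_A$ their negations, $\mathsf{Lit}_A$ the union (with $\neg\neg R(\mathbf a)=R(\mathbf a)$). $X,\overline X$ are disjoint sets of tokens with a bijection $p\mapsto\overline p$; $\mathbb N[X,\overline X]$ is the polynomial semiring $\mathbb N[X\cup\overline X]$ quotiented by the congruence generated by $p\overline p=0$ ($p\in X$). $\mathsf{nnf}$ is standard negation normal form (literals, $x=y$, $x\ne y$, with $\wedge,\vee,\exists,\forall$). For a commutative semiring $K$, a $K$-interpretation $\pi:\mathsf{Lit}_A\to K$ extends to formulas under valuations $\nu$: literals by $\pi$ at ground instances, $x=y$/$x\ne y$ to $1$ if true else $0$, $\wedge\mapsto\cdot$, $\vee\mapsto+$, $\exists x\mapsto\sum_{a\in A}$, $\forall x\mapsto\prod_{a\in A}$ over $\nu[x\mapsto a]$, $\pi[\![\neg\phi]\!]_\nu=\pi[\![\mathsf{nnf}(\neg\phi)]\!]_\nu$; $\pi[\![\phi]\!]$ for sentences. A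 provenance-tracking interpretation is an $\mathbb N[X,\overline X]$-interpretation with $\pi(\mathsf{Facts}_A)\subseteq X\cup\{0,1\}$, $\pi(\mathsf{NegFacts}_A)\subseteq\overline X\cup\{0,1\}$, and with the convention that if $R(\mathbf a)$ is annotated by $p$ then $\overline p$ can annotate only $\neg R(\mathbf a)$ and vice versa. It is model-compatible if for each fact $R(\mathbf a)$ one of: (1) $\pi(R(\mathbf a))=z$ and $\pi(\neg R(\mathbf a))=\overline z$ for some $z\in X$; (2) $\pi(R(\mathbf a))=0$ and $\pi(\neg R(\mathbf a))=1$; (3) $\pi(R(\mathbf a))=1$ and $\pi(\neg R(\mathbf a))=0$. A $\mathscr V$-structure $\mathfrak A$ with universe $A$ is compatible with $\pi$ if $\mathfrak A\models L$ for every literal $L$ with $\pi(L)=1$; $\mathsf{Mod}_\pi$ is the class of such structures. -}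

module Defs where

open import Data.Nat using (ℕ; zero; suc)
open import Data.Fin using (Fin; zero; suc)
open import Data.Bool using (Bool; true; false)
open import Data.Vec using (Vec; map)
open import Data.Product using (Σ; _×_; _,_; ∃)
open import Data.Sum using (_⊎_)
open import Relation.Nullary using (¬_)
open import Relation.Binary.PropositionalEquality using (_≡_)

-- The semiring ℕ[X, X̄] : the free commutative semiring on X ∪ X̄
-- (= polynomials ℕ[X ∪ X̄]) quotiented by the congruence generated by
-- p · p̄ = 0.  Since Agda has no quotient types we use the term algebra
-- together with the congruence _≈_ (a setoid presentation).

data Poly (X : Set) : Set where
  𝟘 𝟙  : Poly X
  var  : X → Poly X
  nvar : X → Poly X
  _⊕_  : Poly X → Poly X → Poly X
  _⊗_  : Poly X → Poly X → Poly X

infixl 6 _⊕_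
infixl 7 _⊗_
infix 4 _≈_

data _≈_ {X : Set} : Poly X → Poly X → Set where
  ≈-refl  : ∀ {a} → a ≈ a
  ≈-sym   : ∀ {a b} → a ≈ b → b ≈ a
  ≈-trans : ∀ {a b c} → a ≈ b → b ≈ c → a ≈ c
  ⊕-cong  : ∀ {a a' b b'} → a ≈ a' → b ≈ b' → a ⊕ b ≈ a' ⊕ b'
  ⊗-cong  : ∀ {a a' b b'} → a ≈ a' → b ≈ b' → a ⊗ b ≈ a' ⊗ b'
  ⊕-assoc : ∀ a b c → (a ⊕ b) ⊕ c ≈ a ⊕ (b ⊕ c)
  ⊕-comm  : ∀ a b → a ⊕ b ≈ b ⊕ a
  ⊕-idˡ   : ∀ a → 𝟘 ⊕ a ≈ a
  ⊗-assoc : ∀ a b c → (a ⊗ b) ⊗ c ≈ a ⊗ (b ⊗ c)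
  ⊗-comm  : ∀ a b → a ⊗ b ≈ b ⊗ a
  ⊗-idˡ   : ∀ a → 𝟙 ⊗ a ≈ a
  distribˡ : ∀ a b c → a ⊗ (b ⊕ c) ≈ (a ⊗ b) ⊕ (a ⊗ c)
  zeroˡ   : ∀ a → 𝟘 ⊗ a ≈ 𝟘
  annihil : ∀ p → var p ⊗ nvar p ≈ 𝟘

record Vocab : Set where
  field
    k  : ℕ
    ar : Fin k → ℕ
open Vocab public

module _ (V : Vocab) (n : ℕ) where

  A : Set
  A = Fin (suc n)

  record Fact : Set where
    constructor fact
    field
      sym  : Fin (k V)
      args : Vec A (ar V sym)

  Lit : Set
  Lit = Bool × Fact

  pos neg : Fact → Lit
  pos f = true , f
  neg f = false , f

  data Formula (m : ℕ) : Set where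
    atom  : (R : Fin (k V)) → Vec (Fin m) (ar V R) → Formula m
    equal : Fin m → Fin m → Formula m
    ¬'_   : Formula m → Formula m
    _∧'_ _∨'_ : Formula m → Formula m → Formula m
    ∃' ∀' : Formula (suc m) → Formula m

  Sentence : Set
  Sentence = Formula 0

  data NNF (m : ℕ) : Set where
    lit   : Bool → (R : Fin (k V)) → Vec (Fin m) (ar V R) → NNF m
    eq neq : Fin m → Fin m → NNF m
    and or : NNF m → NNF m → NNF m
    ex all : NNF (suc m) → NNF m

  -- nnf b φ is nnf(φ) if b = true and nnf(¬φ) if b = false
  nnfP : ∀ {m} → Bool → Formula m → NNF m
  nnfP b (atom R xs) = lit b R xs
  nnfP true (equal x y) = eq x y
  nnfP false (equal x y) = neq x y
  nnfP true (¬' φ) = nnfP false φ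
  nnfP false (¬' φ) = nnfP true φ
  nnfP true (φ ∧' ψ) = and (nnfP true φ) (nnfP true ψ)
  nnfP false (φ ∧' ψ) = or (nnfP false φ) (nnfP false ψ)
  nnfP true (φ ∨' ψ) = or (nnfP true φ) (nnfP true ψ)
  nnfP false (φ ∨' ψ) = and (nnfP false φ) (nnfP false ψ)
  nnfP true (∃' φ) = ex (nnfP true φ)
  nnfP false (∃' φ) = all (nnfP false φ)
  nnfP true (∀' φ) = all (nnfP true φ)
  nnfP false (∀' φ) = ex (nnfP false φ)

  nnf : ∀ {m} → Formula m → NNF m
  nnf = nnfP true

  Val : ℕ → Set
  Val m = Fin m → A

  ext : ∀ {m} → Val m → A → Val (suc m)
  ext ν a zero = a
  ext ν a (suc i) = ν i

  sumFin : ∀ {X} {j} → (Fin j → Poly X) → Poly X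
  sumFin {j = zero} f = 𝟘
  sumFin {j = suc j} f = f zero ⊕ sumFin (λ i → f (suc i))

  prodFin : ∀ {X} {j} → (Fin j → Poly X) → Poly X
  prodFin {j = zero} f = 𝟙
  prodFin {j = suc j} f = f zero ⊗ prodFin (λ i → f (suc i))

  decEqFin : ∀ {j} → Fin j → Fin j → Bool
  decEqFin zero zero = true
  decEqFin zero (suc y) = false
  decEqFin (suc x) zero = false
  decEqFin (suc x) (suc y) = decEqFin x y

  evalNNF : ∀ {X m} → (Lit → Poly X) → NNF m → Val m → Poly X
  evalNNF π (lit b R xs) ν = π (b , fact R (map ν xs))
  evalNNF π (eq x y) ν with decEqFin (ν x) (ν y)
  ... | true = 𝟙
  ... | false = 𝟘
  evalNNF π (neq x y) ν with decEqFin (ν x) (ν y)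
  ... | true = 𝟘
  ... | false = 𝟙
  evalNNF π (and φ ψ) ν = evalNNF π φ ν ⊗ evalNNF π ψ ν
  evalNNF π (or φ ψ) ν = evalNNF π φ ν ⊕ evalNNF π ψ ν
  evalNNF π (ex φ) ν = sumFin (λ a → evalNNF π φ (ext ν a))
  evalNNF π (all φ) ν = prodFin (λ a → evalNNF π φ (ext ν a))

  ⟦_⟧_ : ∀ {X m} → Formula m → (Lit → Poly X) → Val m → Poly X
  ⟦ φ ⟧ π = evalNNF π (nnf φ)

  noVars : Val 0
  noVars ()

  ⟦_⟧ˢ_ : ∀ {X} → Sentence → (Lit → Poly X) → Poly X
  ⟦ φ ⟧ˢ π = (⟦ φ ⟧ π) noVars

  record ProvenanceTracking {X : Set} (π : Lit → Poly X) : Set where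
    field
      facts    : ∀ f → (∃ λ p → π (pos f) ≈ var p) ⊎ (π (pos f) ≈ 𝟘) ⊎ (π (pos f) ≈ 𝟙)
      negfacts : ∀ f → (∃ λ p → π (neg f) ≈ nvar p) ⊎ (π (neg f) ≈ 𝟘) ⊎ (π (neg f) ≈ 𝟙)
      conv₁    : ∀ f g p → π (pos f) ≈ var p → π (neg g) ≈ nvar p → f ≡ g

  record ModelCompatible {X : Set} (π : Lit → Poly X) : Set where
    field
      provTracking : ProvenanceTracking π
      cases : ∀ f →
          (∃ λ z → (π (pos f) ≈ var z) × (π (neg f) ≈ nvar z))
        ⊎ ((π (pos f) ≈ 𝟘) × (π (neg f) ≈ 𝟙))
        ⊎ ((π (pos f) ≈ 𝟙) × (π (neg f) ≈ 𝟘))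

  Structure : Set
  Structure = (R : Fin (k V)) → Vec A (ar V R) → Bool

  _⊨lit_ : Structure → Lit → Set
  𝔄 ⊨lit (b , fact R as) = 𝔄 R as ≡ b

  _⊨_[_] : ∀ {m} → Structure → Formula m → Val m → Set
  𝔄 ⊨ atom R xs [ ν ] = 𝔄 R (map ν xs) ≡ true
  𝔄 ⊨ equal x y [ ν ] = ν x ≡ ν y
  𝔄 ⊨ ¬' φ [ ν ] = ¬ (𝔄 ⊨ φ [ ν ])
  𝔄 ⊨ φ ∧' ψ [ ν ] = (𝔄 ⊨ φ [ ν ]) × (𝔄 ⊨ ψ [ ν ])
  𝔄 ⊨ φ ∨' ψ [ ν ] = (𝔄 ⊨ φ [ ν ]) ⊎ (𝔄 ⊨ ψ [ ν ])
  𝔄 ⊨ ∃' φ [ ν ] = Σ A λ a → 𝔄 ⊨ φ [ ext ν a ]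
  𝔄 ⊨ ∀' φ [ ν ] = (a : A) → 𝔄 ⊨ φ [ ext ν a ]

  CompatibleWith : ∀ {X} → Structure → (Lit → Poly X) → Set
  CompatibleWith 𝔄 π = ∀ L → π L ≈ 𝟙 → 𝔄 ⊨lit L

  ModSatisfiable : ∀ {X} → (Lit → Poly X) → Sentence → Set
  ModSatisfiable π φ = Σ Structure λ 𝔄 → CompatibleWith 𝔄 π × (𝔄 ⊨ φ [ noVars ])

  ModValid : ∀ {X} → (Lit → Poly X) → Sentence → Set
  ModValid π φ = ∀ 𝔄 → CompatibleWith 𝔄 π → 𝔄 ⊨ φ [ noVars ]

module Submission where

open import Defs
open import Data.Nat using (ℕ)
open import Data.Product using (_×_)
open import Function.Bundles using (_⇔_)
open import Relation.Nullary using (¬_)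

open import Level using (0ℓ)
open import Algebra.Bundles using (CommutativeSemiring)
open import Algebra.Structures using (IsCommutativeMonoid)
open import Algebra.Structures.Biased using (isCommutativeMonoidˡ; isCommutativeSemiringʳ)
import Algebra.Properties.CommutativeSemigroup as CommutativeSemigroupProperties
open import Data.Nat using (zero; suc)
open import Data.Fin using (Fin; zero; suc; _≟_)
open import Data.Fin.Properties using (any?; all?; ¬∀⟶∃¬)
open import Data.Bool using (Bool; true; false; not)
open import Data.Bool.Properties using (¬-not; not-¬; not-involutive) renaming (_≟_ to _≟ᵇ_)
open import Data.Vec using (map)
import Data.Vec.Properties as Vec
open import Data.List using (List; []; _∷_; _++_; [_]; cartesianProductWith)
import Data.List.Membership.DecPropositional as DecMembership
open import Data.List.Membership.Propositional using (_∈_)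
open import Data.List.Relation.Unary.All as All using (All; []; _∷_)
import Data.List.Relation.Unary.All.Properties as AllProperties
open import Data.List.Relation.Unary.Any using (Any; here; there)
import Data.List.Relation.Unary.Any.Properties as AnyProperties
open import Data.Product using (Σ; ∃; _,_; proj₁; proj₂)
import Data.Product.Properties as Product
open import Data.Sum using (_⊎_; inj₁; inj₂)
open import Data.Empty using (⊥; ⊥-elim)
import Data.Empty.Polymorphic as Lifted
open import Function using (_∘_)
open import Function.Bundles using (Equivalence; mk⇔)
open import Function.Related.Propositional using (equivalence)
open import Function.Related.TypeIsomorphisms using (×-⊎-commutativeSemiring)
open import Relation.Nullary using (Dec; yes; no)
open import Relation.Nullary.Decidable using (map′; ¬?; _×-dec_; _⊎-dec_; decidable-stable)
open import Relation.Binary.PropositionalEquality using (_≡_; refl; cong; sym; trans; subst)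
import Relation.Binary.Reasoning.Setoid as SetoidReasoning

-- Soundness.  In a compatible structure 𝔄, realise a token p as "some true
-- fact is annotated p" and p̄ as "some false fact is annotated p̄".  By the
-- annotation convention p and p̄ are never both realised, so this is a
-- homomorphism from ℕ[X, X̄] into the semiring of types (logical
-- equivalence) and respects _≈_.  A truth lemma shows that whatever holds
-- in 𝔄 has a realised interpretation, which therefore is not ≈ 𝟘.
-- Completeness.  The interpretation of an NNF formula is ≈ to a sum of
-- monomials (its DNF), and a structure satisfying all literals of one
-- monomial satisfies the formula.  Each monomial either vanishes (it has a
-- literal annotated 0, or both p and p̄) or is satisfied by a compatible
-- structure built literal by literal.  Corollary 3 applies both halves to φ (polarity
-- true) and to ¬φ (polarity false).

-- ℕ[X, X̄] is a commutative semiring: the generators of _≈_ give one side of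
-- each law, the other side follows by commutativity.  Used for derived laws.
polySemiring : (X : Set) → CommutativeSemiring 0ℓ 0ℓ
polySemiring X = record
  { Carrier = Poly X ; _≈_ = _≈_ ; _+_ = _⊕_ ; _*_ = _⊗_ ; 0# = 𝟘 ; 1# = 𝟙
  ; isCommutativeSemiring = isCommutativeSemiringʳ record
    { +-isCommutativeMonoid = commutativeMonoid _⊕_ 𝟘 ⊕-cong ⊕-assoc ⊕-idˡ ⊕-comm
    ; *-isCommutativeMonoid = commutativeMonoid _⊗_ 𝟙 ⊗-cong ⊗-assoc ⊗-idˡ ⊗-comm
    ; distribˡ = distribˡ
    ; zeroʳ    = λ a → ≈-trans (⊗-comm a 𝟘) (zeroˡ a)
    }
  }
  where
  commutativeMonoid : (_∙_ : Poly X → Poly X → Poly X) (ε : Poly X) →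
    (∀ {a a′ b b′} → a ≈ a′ → b ≈ b′ → (a ∙ b) ≈ (a′ ∙ b′)) →
    (∀ a b c → ((a ∙ b) ∙ c) ≈ (a ∙ (b ∙ c))) → (∀ a → (ε ∙ a) ≈ a) →
    (∀ a b → (a ∙ b) ≈ (b ∙ a)) → IsCommutativeMonoid _≈_ _∙_ ε
  commutativeMonoid _∙_ ε cong assoc identityˡ comm = isCommutativeMonoidˡ record
    { isSemigroup = record
      { isMagma = record
        { isEquivalence = record { refl = ≈-refl ; sym = ≈-sym ; trans = ≈-trans }
        ; ∙-cong = cong }
      ; assoc = assoc }
    ; identityˡ = identityˡ
    ; comm = comm
    }

module Evaluation {c ℓ} (K : CommutativeSemiring c ℓ) where
  private module K = CommutativeSemiring K

  module _ {X : Set} (v v̄ : X → K.Carrier)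
           (annihilates : ∀ p → (v p K.* v̄ p) K.≈ K.0#) where

    eval : Poly X → K.Carrier
    eval 𝟘 = K.0#
    eval 𝟙 = K.1#
    eval (var p) = v p
    eval (nvar p) = v̄ p
    eval (a ⊕ b) = eval a K.+ eval b
    eval (a ⊗ b) = eval a K.* eval b

    eval-cong : ∀ {a b} → a ≈ b → eval a K.≈ eval b
    eval-cong ≈-refl = K.refl
    eval-cong (≈-sym e) = K.sym (eval-cong e)
    eval-cong (≈-trans e e′) = K.trans (eval-cong e) (eval-cong e′)
    eval-cong (⊕-cong e e′) = K.+-cong (eval-cong e) (eval-cong e′)
    eval-cong (⊗-cong e e′) = K.*-cong (eval-cong e) (eval-cong e′)
    eval-cong (⊕-assoc a b c) = K.+-assoc (eval a) (eval b) (eval c)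
    eval-cong (⊕-comm a b) = K.+-comm (eval a) (eval b)
    eval-cong (⊕-idˡ a) = K.+-identityˡ (eval a)
    eval-cong (⊗-assoc a b c) = K.*-assoc (eval a) (eval b) (eval c)
    eval-cong (⊗-comm a b) = K.*-comm (eval a) (eval b)
    eval-cong (⊗-idˡ a) = K.*-identityˡ (eval a)
    eval-cong (distribˡ a b c) = K.distribˡ (eval a) (eval b) (eval c)
    eval-cong (zeroˡ a) = K.zeroˡ (eval a)
    eval-cong (annihil p) = annihilates p

module Realisation {X : Set} (T T̄ : X → Set) (disjoint : ∀ p → T p → ¬ T̄ p) where
  open Evaluation (×-⊎-commutativeSemiring equivalence 0ℓ)

  annihilation : ∀ p → (T p × T̄ p) ⇔ Lifted.⊥ {0ℓ}
  annihilation p = mk⇔ (λ { (t , t̄) → ⊥-elim (disjoint p t t̄) }) Lifted.⊥-elim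

  ⟪_⟫ : Poly X → Set
  ⟪_⟫ = eval T T̄ annihilation

  ⟪⟫-cong : ∀ {a b} → a ≈ b → ⟪ a ⟫ ⇔ ⟪ b ⟫
  ⟪⟫-cong = eval-cong T T̄ annihilation

  realised⇒≉𝟘 : ∀ {a} → ⟪ a ⟫ → ¬ a ≈ 𝟘
  realised⇒≉𝟘 r a≈𝟘 = Lifted.⊥-elim (Equivalence.to (⟪⟫-cong a≈𝟘) r)

  unrealised⇒≉𝟙 : ∀ {a} → ¬ ⟪ a ⟫ → ¬ a ≈ 𝟙
  unrealised⇒≉𝟙 ¬r a≈𝟙 = ¬r (Equivalence.from (⟪⟫-cong a≈𝟙) _)

-- 𝟘 and the tokens are not ≈ 𝟙: realise every token by the empty type.
≉𝟙 : ∀ {X} {a : Poly X} → ¬ Realisation.⟪_⟫ (λ _ → ⊥) (λ _ → ⊥) (λ _ ()) a → ¬ a ≈ 𝟙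
≉𝟙 = Realisation.unrealised⇒≉𝟙 (λ _ → ⊥) (λ _ → ⊥) (λ _ ())

_⊠_ : {L : Set} → List (List L) → List (List L) → List (List L)
_⊠_ = cartesianProductWith _++_

infixr 7 _⊠_

module Expansion {X L : Set} (w : L → Poly X) where
  open CommutativeSemiring (polySemiring X) using (setoid; zeroʳ; distribʳ; *-commutativeSemigroup)
  open CommutativeSemigroupProperties *-commutativeSemigroup using (x∙yz≈y∙xz)
  open SetoidReasoning setoid

  mono : List L → Poly X
  mono [] = 𝟙
  mono (l ∷ S) = w l ⊗ mono S

  poly : List (List L) → Poly X
  poly [] = 𝟘
  poly (S ∷ D) = mono S ⊕ poly D

  mono-++ : ∀ S T → mono (S ++ T) ≈ mono S ⊗ mono T
  mono-++ [] T = ≈-sym (⊗-idˡ (mono T))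
  mono-++ (l ∷ S) T = begin
    w l ⊗ mono (S ++ T)       ≈⟨ ⊗-cong ≈-refl (mono-++ S T) ⟩
    w l ⊗ (mono S ⊗ mono T)   ≈⟨ ≈-sym (⊗-assoc (w l) (mono S) (mono T)) ⟩
    w l ⊗ mono S ⊗ mono T     ∎

  poly-++ : ∀ D E → poly (D ++ E) ≈ poly D ⊕ poly E
  poly-++ [] E = ≈-sym (⊕-idˡ (poly E))
  poly-++ (S ∷ D) E = begin
    mono S ⊕ poly (D ++ E)      ≈⟨ ⊕-cong ≈-refl (poly-++ D E) ⟩
    mono S ⊕ (poly D ⊕ poly E)  ≈⟨ ≈-sym (⊕-assoc (mono S) (poly D) (poly E)) ⟩
    mono S ⊕ poly D ⊕ poly E    ∎

  poly-map : ∀ S E → poly (Data.List.map (S ++_) E) ≈ mono S ⊗ poly E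
  poly-map S [] = ≈-sym (zeroʳ (mono S))
  poly-map S (T ∷ E) = begin
    mono (S ++ T) ⊕ poly (Data.List.map (S ++_) E)  ≈⟨ ⊕-cong (mono-++ S T) (poly-map S E) ⟩
    mono S ⊗ mono T ⊕ mono S ⊗ poly E               ≈⟨ ≈-sym (distribˡ (mono S) (mono T) (poly E)) ⟩
    mono S ⊗ (mono T ⊕ poly E)                      ∎

  poly-⊠ : ∀ D E → poly (D ⊠ E) ≈ poly D ⊗ poly E
  poly-⊠ [] E = ≈-sym (zeroˡ (poly E))
  poly-⊠ (S ∷ D) E = begin
    poly (Data.List.map (S ++_) E ++ D ⊠ E)        ≈⟨ poly-++ (Data.List.map (S ++_) E) (D ⊠ E) ⟩
    poly (Data.List.map (S ++_) E) ⊕ poly (D ⊠ E)  ≈⟨ ⊕-cong (poly-map S E) (poly-⊠ D E) ⟩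
    mono S ⊗ poly E ⊕ poly D ⊗ poly E              ≈⟨ ≈-sym (distribʳ (poly E) (mono S) (poly D)) ⟩
    (mono S ⊕ poly D) ⊗ poly E                     ∎

  mono-factor : ∀ {l S} → l ∈ S → Σ (Poly X) λ r → mono S ≈ w l ⊗ r
  mono-factor {S = l ∷ S} (here refl) = mono S , ≈-refl
  mono-factor {S = l′ ∷ S} (there l∈S) with mono-factor l∈S
  ... | r , e = w l′ ⊗ r , ≈-trans (⊗-cong ≈-refl e) (x∙yz≈y∙xz (w l′) _ r)

module _ (V : Vocab) (n : ℕ) where

  _⊨ˡ_ : Structure V n → Lit V n → Set
  _⊨ˡ_ = _⊨lit_ V n

  _⊨ᶠ_[_] : ∀ {m} → Structure V n → Formula V n m → Val V n m → Set
  _⊨ᶠ_[_] = _⊨_[_] V n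

  complement : Lit V n → Lit V n
  complement (b , f) = not b , f

  Monomial : Set
  Monomial = List (Lit V n)

  ⋁ ⋀ : ∀ {j} → (Fin j → List Monomial) → List Monomial
  ⋁ {zero} F = []
  ⋁ {suc j} F = F zero ++ ⋁ (F ∘ suc)
  ⋀ {zero} F = [ [] ]
  ⋀ {suc j} F = F zero ⊠ ⋀ (F ∘ suc)

  sumFin-cong : ∀ {X j} {f g : Fin j → Poly X} → (∀ a → f a ≈ g a) → sumFin V n f ≈ sumFin V n g
  sumFin-cong {j = zero} f≈g = ≈-refl
  sumFin-cong {j = suc j} f≈g = ⊕-cong (f≈g zero) (sumFin-cong (f≈g ∘ suc))

  prodFin-cong : ∀ {X j} {f g : Fin j → Poly X} → (∀ a → f a ≈ g a) → prodFin V n f ≈ prodFin V n g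
  prodFin-cong {j = zero} f≈g = ≈-refl
  prodFin-cong {j = suc j} f≈g = ⊗-cong (f≈g zero) (prodFin-cong (f≈g ∘ suc))

  module _ {X : Set} (π : Lit V n → Poly X) where
    open Expansion π
    open CommutativeSemiring (polySemiring X) using (+-identityʳ)

    poly-⋁ : ∀ {j} (F : Fin j → List Monomial) → poly (⋁ F) ≈ sumFin V n (poly ∘ F)
    poly-⋁ {zero} F = ≈-refl
    poly-⋁ {suc j} F = ≈-trans (poly-++ (F zero) (⋁ (F ∘ suc))) (⊕-cong ≈-refl (poly-⋁ (F ∘ suc)))

    poly-⋀ : ∀ {j} (F : Fin j → List Monomial) → poly (⋀ F) ≈ prodFin V n (poly ∘ F)
    poly-⋀ {zero} F = +-identityʳ 𝟙
    poly-⋀ {suc j} F = ≈-trans (poly-⊠ (F zero) (⋀ (F ∘ suc))) (⊗-cong ≈-refl (poly-⋀ (F ∘ suc)))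

  module _ (P : Lit V n → Set) where

    ⊠-satisfied : ∀ D E → Any (All P) (D ⊠ E) → Any (All P) D × Any (All P) E
    ⊠-satisfied = AnyProperties.cartesianProductWith⁻ _++_ (λ {S} → AllProperties.++⁻ S)

    ⋁-satisfied : ∀ {j} (F : Fin j → List Monomial) → Any (All P) (⋁ F) → ∃ λ a → Any (All P) (F a)
    ⋁-satisfied {suc j} F s with AnyProperties.++⁻ (F zero) s
    ... | inj₁ s₀ = zero , s₀
    ... | inj₂ s′ with ⋁-satisfied (F ∘ suc) s′
    ...   | a , sₐ = suc a , sₐ

    ⋀-satisfied : ∀ {j} (F : Fin j → List Monomial) → Any (All P) (⋀ F) → ∀ a → Any (All P) (F a)
    ⋀-satisfied {suc j} F s zero = proj₁ (⊠-satisfied (F zero) (⋀ (F ∘ suc)) s)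
    ⋀-satisfied {suc j} F s (suc a) =
      ⋀-satisfied (F ∘ suc) (proj₂ (⊠-satisfied (F zero) (⋀ (F ∘ suc)) s)) a

  decEqFin-sound : ∀ {j} (a b : Fin j) → decEqFin V n a b ≡ true → a ≡ b
  decEqFin-sound zero zero _ = refl
  decEqFin-sound (suc a) (suc b) e = cong suc (decEqFin-sound a b e)

  decEqFin-refl : ∀ {j} (a : Fin j) → decEqFin V n a a ≡ true
  decEqFin-refl zero = refl
  decEqFin-refl (suc a) = decEqFin-refl a

  decEqFin-false : ∀ {j} {a b : Fin j} → decEqFin V n a b ≡ false → ¬ a ≡ b
  decEqFin-false {a = a} e refl with trans (sym e) (decEqFin-refl a)
  ... | ()

  _⊨ₙ_[_] : ∀ {m} → Structure V n → NNF V n m → Val V n m → Set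
  𝔄 ⊨ₙ lit b R xs [ ν ] = 𝔄 R (map ν xs) ≡ b
  𝔄 ⊨ₙ eq x y [ ν ] = ν x ≡ ν y
  𝔄 ⊨ₙ neq x y [ ν ] = ¬ ν x ≡ ν y
  𝔄 ⊨ₙ and ψ χ [ ν ] = (𝔄 ⊨ₙ ψ [ ν ]) × (𝔄 ⊨ₙ χ [ ν ])
  𝔄 ⊨ₙ or ψ χ [ ν ] = (𝔄 ⊨ₙ ψ [ ν ]) ⊎ (𝔄 ⊨ₙ χ [ ν ])
  𝔄 ⊨ₙ ex ψ [ ν ] = Σ (A V n) λ a → 𝔄 ⊨ₙ ψ [ ext V n ν a ]
  𝔄 ⊨ₙ all ψ [ ν ] = (a : A V n) → 𝔄 ⊨ₙ ψ [ ext V n ν a ]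

  truthDNF : Bool → List Monomial
  truthDNF true = [ [] ]
  truthDNF false = []

  dnf : ∀ {m} → NNF V n m → Val V n m → List Monomial
  dnf (lit b R xs) ν = [ [ (b , fact R (map ν xs)) ] ]
  dnf (eq x y) ν = truthDNF (decEqFin V n (ν x) (ν y))
  dnf (neq x y) ν = truthDNF (not (decEqFin V n (ν x) (ν y)))
  dnf (and ψ χ) ν = dnf ψ ν ⊠ dnf χ ν
  dnf (or ψ χ) ν = dnf ψ ν ++ dnf χ ν
  dnf (ex ψ) ν = ⋁ λ a → dnf ψ (ext V n ν a)
  dnf (all ψ) ν = ⋀ λ a → dnf ψ (ext V n ν a)

  dnf-poly : ∀ {X m} (π : Lit V n → Poly X) (ψ : NNF V n m) ν →
    evalNNF V n π ψ ν ≈ Expansion.poly π (dnf ψ ν)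
  dnf-poly {X} π (lit b R xs) ν = ≈-sym (≈-trans (+-identityʳ _) (*-identityʳ _))
    where open CommutativeSemiring (polySemiring X) using (+-identityʳ; *-identityʳ)
  dnf-poly {X} π (eq x y) ν with decEqFin V n (ν x) (ν y)
  ... | true = ≈-sym (CommutativeSemiring.+-identityʳ (polySemiring X) 𝟙)
  ... | false = ≈-refl
  dnf-poly {X} π (neq x y) ν with decEqFin V n (ν x) (ν y)
  ... | true = ≈-refl
  ... | false = ≈-sym (CommutativeSemiring.+-identityʳ (polySemiring X) 𝟙)
  dnf-poly π (and ψ χ) ν =
    ≈-trans (⊗-cong (dnf-poly π ψ ν) (dnf-poly π χ ν)) (≈-sym (Expansion.poly-⊠ π (dnf ψ ν) (dnf χ ν)))
  dnf-poly π (or ψ χ) ν =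
    ≈-trans (⊕-cong (dnf-poly π ψ ν) (dnf-poly π χ ν)) (≈-sym (Expansion.poly-++ π (dnf ψ ν) (dnf χ ν)))
  dnf-poly π (ex ψ) ν =
    ≈-trans (sumFin-cong λ a → dnf-poly π ψ (ext V n ν a)) (≈-sym (poly-⋁ π λ a → dnf ψ (ext V n ν a)))
  dnf-poly π (all ψ) ν =
    ≈-trans (prodFin-cong λ a → dnf-poly π ψ (ext V n ν a)) (≈-sym (poly-⋀ π λ a → dnf ψ (ext V n ν a)))

  dnf-sound : ∀ {m} 𝔄 (ψ : NNF V n m) ν → Any (All (𝔄 ⊨ˡ_)) (dnf ψ ν) → 𝔄 ⊨ₙ ψ [ ν ]
  dnf-sound 𝔄 (lit b R xs) ν (here (s ∷ [])) = s
  dnf-sound 𝔄 (eq x y) ν s with decEqFin V n (ν x) (ν y) in e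
  dnf-sound 𝔄 (eq x y) ν (here []) | true = decEqFin-sound (ν x) (ν y) e
  dnf-sound 𝔄 (neq x y) ν s with decEqFin V n (ν x) (ν y) in e
  dnf-sound 𝔄 (neq x y) ν (here []) | false = decEqFin-false e
  dnf-sound 𝔄 (and ψ χ) ν s with ⊠-satisfied (𝔄 ⊨ˡ_) (dnf ψ ν) (dnf χ ν) s
  ... | sψ , sχ = dnf-sound 𝔄 ψ ν sψ , dnf-sound 𝔄 χ ν sχ
  dnf-sound 𝔄 (or ψ χ) ν s with AnyProperties.++⁻ (dnf ψ ν) s
  ... | inj₁ sψ = inj₁ (dnf-sound 𝔄 ψ ν sψ)
  ... | inj₂ sχ = inj₂ (dnf-sound 𝔄 χ ν sχ)
  dnf-sound 𝔄 (ex ψ) ν s with ⋁-satisfied (𝔄 ⊨ˡ_) (λ a → dnf ψ (ext V n ν a)) s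
  ... | a , sₐ = a , dnf-sound 𝔄 ψ (ext V n ν a) sₐ
  dnf-sound 𝔄 (all ψ) ν s a =
    dnf-sound 𝔄 ψ (ext V n ν a) (⋀-satisfied (𝔄 ⊨ˡ_) (λ a → dnf ψ (ext V n ν a)) s a)

  _⊨⟨_⟩_[_] : ∀ {m} → Structure V n → Bool → Formula V n m → Val V n m → Set
  𝔄 ⊨⟨ true ⟩ φ [ ν ] = 𝔄 ⊨ᶠ φ [ ν ]
  𝔄 ⊨⟨ false ⟩ φ [ ν ] = ¬ 𝔄 ⊨ᶠ φ [ ν ]

  sat? : ∀ {m} 𝔄 (φ : Formula V n m) ν → Dec (𝔄 ⊨ᶠ φ [ ν ])
  sat? 𝔄 (atom R xs) ν = 𝔄 R (map ν xs) ≟ᵇ true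
  sat? 𝔄 (equal x y) ν = ν x ≟ ν y
  sat? 𝔄 (¬' φ) ν = ¬? (sat? 𝔄 φ ν)
  sat? 𝔄 (φ ∧' ψ) ν = sat? 𝔄 φ ν ×-dec sat? 𝔄 ψ ν
  sat? 𝔄 (φ ∨' ψ) ν = sat? 𝔄 φ ν ⊎-dec sat? 𝔄 ψ ν
  sat? 𝔄 (∃' φ) ν = any? λ a → sat? 𝔄 φ (ext V n ν a)
  sat? 𝔄 (∀' φ) ν = all? λ a → sat? 𝔄 φ (ext V n ν a)

  -- Correctness of negation normal form in both directions; the direction
  -- into NNF needs decidability to push negation through ¬, ∧ and ∀.
  to-nnf : ∀ {m} 𝔄 b (φ : Formula V n m) ν → 𝔄 ⊨⟨ b ⟩ φ [ ν ] → 𝔄 ⊨ₙ nnfP V n b φ [ ν ]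
  to-nnf 𝔄 true (atom R xs) ν s = s
  to-nnf 𝔄 false (atom R xs) ν s = ¬-not s
  to-nnf 𝔄 true (equal x y) ν s = s
  to-nnf 𝔄 false (equal x y) ν s = s
  to-nnf 𝔄 true (¬' φ) ν s = to-nnf 𝔄 false φ ν s
  to-nnf 𝔄 false (¬' φ) ν s = to-nnf 𝔄 true φ ν (decidable-stable (sat? 𝔄 φ ν) s)
  to-nnf 𝔄 true (φ ∧' ψ) ν (s , t) = to-nnf 𝔄 true φ ν s , to-nnf 𝔄 true ψ ν t
  to-nnf 𝔄 false (φ ∧' ψ) ν s with sat? 𝔄 φ ν
  ... | yes sφ = inj₂ (to-nnf 𝔄 false ψ ν λ sψ → s (sφ , sψ))
  ... | no ¬sφ = inj₁ (to-nnf 𝔄 false φ ν ¬sφ)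
  to-nnf 𝔄 true (φ ∨' ψ) ν (inj₁ s) = inj₁ (to-nnf 𝔄 true φ ν s)
  to-nnf 𝔄 true (φ ∨' ψ) ν (inj₂ t) = inj₂ (to-nnf 𝔄 true ψ ν t)
  to-nnf 𝔄 false (φ ∨' ψ) ν s = to-nnf 𝔄 false φ ν (s ∘ inj₁) , to-nnf 𝔄 false ψ ν (s ∘ inj₂)
  to-nnf 𝔄 true (∃' φ) ν (a , s) = a , to-nnf 𝔄 true φ (ext V n ν a) s
  to-nnf 𝔄 false (∃' φ) ν s a = to-nnf 𝔄 false φ (ext V n ν a) λ sₐ → s (a , sₐ)
  to-nnf 𝔄 true (∀' φ) ν s a = to-nnf 𝔄 true φ (ext V n ν a) (s a)
  to-nnf 𝔄 false (∀' φ) ν s with ¬∀⟶∃¬ (suc n) _ (λ a → sat? 𝔄 φ (ext V n ν a)) s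
  ... | a , ¬sₐ = a , to-nnf 𝔄 false φ (ext V n ν a) ¬sₐ

  from-nnf : ∀ {m} 𝔄 b (φ : Formula V n m) ν → 𝔄 ⊨ₙ nnfP V n b φ [ ν ] → 𝔄 ⊨⟨ b ⟩ φ [ ν ]
  from-nnf 𝔄 true (atom R xs) ν s = s
  from-nnf 𝔄 false (atom R xs) ν s = not-¬ s
  from-nnf 𝔄 true (equal x y) ν s = s
  from-nnf 𝔄 false (equal x y) ν s = s
  from-nnf 𝔄 true (¬' φ) ν s = from-nnf 𝔄 false φ ν s
  from-nnf 𝔄 false (¬' φ) ν s ¬sφ = ¬sφ (from-nnf 𝔄 true φ ν s)
  from-nnf 𝔄 true (φ ∧' ψ) ν (s , t) = from-nnf 𝔄 true φ ν s , from-nnf 𝔄 true ψ ν t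
  from-nnf 𝔄 false (φ ∧' ψ) ν (inj₁ s) (sφ , _) = from-nnf 𝔄 false φ ν s sφ
  from-nnf 𝔄 false (φ ∧' ψ) ν (inj₂ t) (_ , sψ) = from-nnf 𝔄 false ψ ν t sψ
  from-nnf 𝔄 true (φ ∨' ψ) ν (inj₁ s) = inj₁ (from-nnf 𝔄 true φ ν s)
  from-nnf 𝔄 true (φ ∨' ψ) ν (inj₂ t) = inj₂ (from-nnf 𝔄 true ψ ν t)
  from-nnf 𝔄 false (φ ∨' ψ) ν (s , t) (inj₁ sφ) = from-nnf 𝔄 false φ ν s sφ
  from-nnf 𝔄 false (φ ∨' ψ) ν (s , t) (inj₂ sψ) = from-nnf 𝔄 false ψ ν t sψ
  from-nnf 𝔄 true (∃' φ) ν (a , s) = a , from-nnf 𝔄 true φ (ext V n ν a) s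
  from-nnf 𝔄 false (∃' φ) ν s (a , sₐ) = from-nnf 𝔄 false φ (ext V n ν a) (s a) sₐ
  from-nnf 𝔄 true (∀' φ) ν s a = from-nnf 𝔄 true φ (ext V n ν a) (s a)
  from-nnf 𝔄 false (∀' φ) ν (a , s) sφ = from-nnf 𝔄 false φ (ext V n ν a) s (sφ a)

  _≟ᶠ_ : (f g : Fact V n) → Dec (f ≡ g)
  fact R as ≟ᶠ fact R′ as′ with R ≟ R′
  ... | no R≢R′ = no λ { refl → R≢R′ refl }
  ... | yes refl = map′ (cong (fact R)) (λ { refl → refl }) (Vec.≡-dec _≟_ as as′)

  _≟ˡ_ : (L L′ : Lit V n) → Dec (L ≡ L′)
  _≟ˡ_ = Product.≡-dec _≟ᵇ_ _≟ᶠ_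

  open DecMembership _≟ˡ_ using (_∈?_)

  _⊨ˡ?_ : ∀ 𝔄 L → Dec (𝔄 ⊨ˡ L)
  𝔄 ⊨ˡ? (b , fact R as) = 𝔄 R as ≟ᵇ b

  set : Structure V n → Lit V n → Structure V n
  set 𝔄 (b , f) R as with fact R as ≟ᶠ f
  ... | yes _ = b
  ... | no _ = 𝔄 R as

  set-sets : ∀ 𝔄 L → set 𝔄 L ⊨ˡ L
  set-sets 𝔄 (b , fact R as) with fact R as ≟ᶠ fact R as
  ... | yes _ = refl
  ... | no ≢ = ⊥-elim (≢ refl)

  set-preserves : ∀ 𝔄 L {L′} → 𝔄 ⊨ˡ L′ → ¬ L′ ≡ complement L → set 𝔄 L ⊨ˡ L′
  set-preserves 𝔄 (b , f) {b′ , fact R as} s ≢ with fact R as ≟ᶠ f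
  ... | yes refl = sym (trans (¬-not (≢ ∘ cong (_, fact R as))) (not-involutive b))
  ... | no _ = s

  module _ {X : Set} {T T̄ : X → Set} (disjoint : ∀ p → T p → ¬ T̄ p) where
    open Realisation T T̄ disjoint

    sumFin-realised : ∀ {j} (f : Fin j → Poly X) (a : Fin j) → ⟪ f a ⟫ → ⟪ sumFin V n f ⟫
    sumFin-realised f zero r = inj₁ r
    sumFin-realised f (suc a) r = inj₂ (sumFin-realised (f ∘ suc) a r)

    prodFin-realised : ∀ {j} (f : Fin j → Poly X) → (∀ a → ⟪ f a ⟫) → ⟪ prodFin V n f ⟫
    prodFin-realised {zero} f r = _
    prodFin-realised {suc j} f r = r zero , prodFin-realised (f ∘ suc) (r ∘ suc)

  module _ {X : Set} {π : Lit V n → Poly X} (mc : ModelCompatible V n π) where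
    open ModelCompatible mc
    open ProvenanceTracking provTracking
    open Expansion π
    open CommutativeSemiring (polySemiring X) using (zeroʳ; setoid)
    open SetoidReasoning setoid

    Compatible : Structure V n → Set
    Compatible 𝔄 = CompatibleWith V n 𝔄 π

    ∃Compatible : (Structure V n → Set) → Set
    ∃Compatible Q = Σ (Structure V n) λ 𝔄 → Compatible 𝔄 × Q 𝔄

    -- In a compatible structure 𝔄, realise p by a true fact annotated p and
    -- p̄ by a false fact annotated p̄; by the annotation convention these
    -- would be the same fact, so they cannot both exist.
    module Truth (𝔄 : Structure V n) (compatible : Compatible 𝔄) where

      TrueFactAt FalseFactAt : X → Set
      TrueFactAt p = Σ (Fact V n) λ f → (π (pos V n f) ≈ var p) × 𝔄 ⊨ˡ pos V n f
      FalseFactAt p = Σ (Fact V n) λ f → (π (neg V n f) ≈ nvar p) × 𝔄 ⊨ˡ neg V n f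

      true-false-disjoint : ∀ p → TrueFactAt p → ¬ FalseFactAt p
      true-false-disjoint p (f , e₁ , s₁) (g , e₂ , s₂) with refl ← conv₁ f g p e₁ e₂ = not-¬ s₂ s₁

      open Realisation TrueFactAt FalseFactAt true-false-disjoint public

      literal-realised : ∀ L → 𝔄 ⊨ˡ L → ⟪ π L ⟫
      literal-realised (b , f) s with cases f
      literal-realised (true , f) s | inj₁ (z , e₁ , e₂) = Equivalence.from (⟪⟫-cong e₁) (f , e₁ , s)
      literal-realised (false , f) s | inj₁ (z , e₁ , e₂) = Equivalence.from (⟪⟫-cong e₂) (f , e₂ , s)
      literal-realised (true , f) s | inj₂ (inj₁ (e₁ , e₂)) = ⊥-elim (not-¬ (compatible (neg V n f) e₂) s)
      literal-realised (false , f) s | inj₂ (inj₁ (e₁ , e₂)) = Equivalence.from (⟪⟫-cong e₂) _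
      literal-realised (true , f) s | inj₂ (inj₂ (e₁ , e₂)) = Equivalence.from (⟪⟫-cong e₁) _
      literal-realised (false , f) s | inj₂ (inj₂ (e₁ , e₂)) = ⊥-elim (not-¬ (compatible (pos V n f) e₁) s)

      truth : ∀ {m} (ψ : NNF V n m) ν → 𝔄 ⊨ₙ ψ [ ν ] → ⟪ evalNNF V n π ψ ν ⟫
      truth (lit b R xs) ν s = literal-realised (b , fact R (map ν xs)) s
      truth (eq x y) ν s with decEqFin V n (ν x) (ν y) in e
      ... | true = _
      ... | false = ⊥-elim (decEqFin-false e s)
      truth (neq x y) ν s with decEqFin V n (ν x) (ν y) in e
      ... | true = ⊥-elim (s (decEqFin-sound (ν x) (ν y) e))
      ... | false = _
      truth (and ψ χ) ν (s , t) = truth ψ ν s , truth χ ν t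
      truth (or ψ χ) ν (inj₁ s) = inj₁ (truth ψ ν s)
      truth (or ψ χ) ν (inj₂ t) = inj₂ (truth χ ν t)
      truth (ex ψ) ν (a , s) =
        sumFin-realised true-false-disjoint (λ a → evalNNF V n π ψ (ext V n ν a)) a (truth ψ (ext V n ν a) s)
      truth (all ψ) ν s =
        prodFin-realised true-false-disjoint (λ a → evalNNF V n π ψ (ext V n ν a))
          λ a → truth ψ (ext V n ν a) (s a)

    model⇒nonzero : ∀ {𝔄} → Compatible 𝔄 → ∀ b φ →
      𝔄 ⊨⟨ b ⟩ φ [ noVars V n ] → ¬ evalNNF V n π (nnfP V n b φ) (noVars V n) ≈ 𝟘
    model⇒nonzero {𝔄} c b φ s =
      realised⇒≉𝟘 (truth (nnfP V n b φ) (noVars V n) (to-nnf 𝔄 b φ (noVars V n) s))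
      where open Truth 𝔄 c

    -- A fact is free when neither of its literals is annotated 1: it can be
    -- given either truth value without violating compatibility.
    Free : Fact V n → Set
    Free f = ∀ b → ¬ π (b , f) ≈ 𝟙

    token-free : ∀ {f z} → π (pos V n f) ≈ var z → π (neg V n f) ≈ nvar z → Free f
    token-free {z = z} e₁ e₂ true e = ≉𝟙 {a = var z} (λ ()) (≈-trans (≈-sym e₁) e)
    token-free {z = z} e₁ e₂ false e = ≉𝟙 {a = nvar z} (λ ()) (≈-trans (≈-sym e₂) e)

    zero-not-one : ∀ {L} → π L ≈ 𝟘 → ¬ π L ≈ 𝟙
    zero-not-one e₀ e₁ = ≉𝟙 {a = 𝟘} (λ ()) (≈-trans (≈-sym e₀) e₁)

    -- the structure in which exactly the facts annotated 1 are true
    default : Structure V n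
    default R as = annotatedOne (cases (fact R as))
      where
      annotatedOne : ∀ {P Q S : Set} → P ⊎ Q ⊎ S → Bool
      annotatedOne (inj₂ (inj₂ _)) = true
      annotatedOne _ = false

    default-compatible : Compatible default
    default-compatible (b , fact R as) e with cases (fact R as)
    ... | inj₁ (z , e₁ , e₂) = ⊥-elim (token-free e₁ e₂ b e)
    default-compatible (true , fact R as) e | inj₂ (inj₁ (e₁ , e₂)) = ⊥-elim (zero-not-one e₁ e)
    default-compatible (false , fact R as) e | inj₂ (inj₁ (e₁ , e₂)) = refl
    default-compatible (true , fact R as) e | inj₂ (inj₂ (e₁ , e₂)) = refl
    default-compatible (false , fact R as) e | inj₂ (inj₂ (e₁ , e₂)) = ⊥-elim (zero-not-one e₂ e)

    set-compatible : ∀ {𝔄} b {f} → Free f → Compatible 𝔄 → Compatible (set 𝔄 (b , f))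
    set-compatible b {f} free c (b′ , fact R as) e with fact R as ≟ᶠ f
    ... | yes refl = ⊥-elim (free b′ e)
    ... | no _ = c (b′ , fact R as) e

    refuted-or-free : ∀ {𝔄} → Compatible 𝔄 → ∀ L → ¬ 𝔄 ⊨ˡ L → (π L ≈ 𝟘) ⊎ Free (proj₂ L)
    refuted-or-free c (b , f) ¬s with cases f
    ... | inj₁ (z , e₁ , e₂) = inj₂ (token-free e₁ e₂)
    refuted-or-free c (true , f) ¬s | inj₂ (inj₁ (e₁ , e₂)) = inj₁ e₁
    refuted-or-free c (false , f) ¬s | inj₂ (inj₁ (e₁ , e₂)) = ⊥-elim (¬s (c (neg V n f) e₂))
    refuted-or-free c (true , f) ¬s | inj₂ (inj₂ (e₁ , e₂)) = ⊥-elim (¬s (c (pos V n f) e₁))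
    refuted-or-free c (false , f) ¬s | inj₂ (inj₂ (e₁ , e₂)) = inj₁ e₂

    pos-neg-annihilate : ∀ f → π (pos V n f) ⊗ π (neg V n f) ≈ 𝟘
    pos-neg-annihilate f with cases f
    ... | inj₁ (z , e₁ , e₂) = ≈-trans (⊗-cong e₁ e₂) (annihil z)
    ... | inj₂ (inj₁ (e₁ , _)) = ≈-trans (⊗-cong e₁ ≈-refl) (zeroˡ _)
    ... | inj₂ (inj₂ (_ , e₂)) = ≈-trans (⊗-cong ≈-refl e₂) (zeroʳ _)

    complement-annihilates : ∀ L → π L ⊗ π (complement L) ≈ 𝟘
    complement-annihilates (true , f) = pos-neg-annihilate f
    complement-annihilates (false , f) = ≈-trans (⊗-comm _ _) (pos-neg-annihilate f)

    complementary-vanishes : ∀ L S → complement L ∈ S → π L ⊗ mono S ≈ 𝟘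
    complementary-vanishes L S L̄∈S with mono-factor L̄∈S
    ... | r , S≈L̄r = begin
      π L ⊗ mono S                  ≈⟨ ⊗-cong ≈-refl S≈L̄r ⟩
      π L ⊗ (π (complement L) ⊗ r)  ≈⟨ ≈-sym (⊗-assoc _ _ r) ⟩
      π L ⊗ π (complement L) ⊗ r    ≈⟨ ⊗-cong (complement-annihilates L) ≈-refl ⟩
      𝟘 ⊗ r                         ≈⟨ zeroˡ r ⟩
      𝟘                             ∎

    -- Every monomial vanishes or is satisfied by a compatible structure,
    -- built literal by literal: a literal not yet true is annotated 0, or its
    -- fact is free and is set -- unless the complementary literal occurs too.
    monomial-dichotomy : ∀ S → (mono S ≈ 𝟘) ⊎ ∃Compatible λ 𝔄 → All (𝔄 ⊨ˡ_) S
    monomial-dichotomy [] = inj₂ (default , default-compatible , [])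
    monomial-dichotomy (L ∷ S) with monomial-dichotomy S
    ... | inj₁ S≈𝟘 = inj₁ (≈-trans (⊗-cong ≈-refl S≈𝟘) (zeroʳ (π L)))
    ... | inj₂ (𝔄 , c , sat) with 𝔄 ⊨ˡ? L
    ...   | yes s = inj₂ (𝔄 , c , s ∷ sat)
    ...   | no ¬s with refuted-or-free c L ¬s
    ...     | inj₁ L≈𝟘 = inj₁ (≈-trans (⊗-cong L≈𝟘 ≈-refl) (zeroˡ (mono S)))
    ...     | inj₂ free with complement L ∈? S
    ...       | yes L̄∈S = inj₁ (complementary-vanishes L S L̄∈S)
    ...       | no L̄∉S =
      inj₂ (set 𝔄 L , set-compatible (proj₁ L) free c , set-sets 𝔄 L ∷ All.tabulate keep)
      where
      keep : ∀ {L′} → L′ ∈ S → set 𝔄 L ⊨ˡ L′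
      keep L′∈S = set-preserves 𝔄 L (All.lookup sat L′∈S)
        λ L′≡L̄ → L̄∉S (subst (_∈ S) L′≡L̄ L′∈S)

    poly-dichotomy : ∀ D → (poly D ≈ 𝟘) ⊎ ∃Compatible λ 𝔄 → Any (All (𝔄 ⊨ˡ_)) D
    poly-dichotomy [] = inj₁ ≈-refl
    poly-dichotomy (S ∷ D) with monomial-dichotomy S | poly-dichotomy D
    ... | inj₂ (𝔄 , c , s) | _ = inj₂ (𝔄 , c , here s)
    ... | inj₁ _ | inj₂ (𝔄 , c , s) = inj₂ (𝔄 , c , there s)
    ... | inj₁ S≈𝟘 | inj₁ D≈𝟘 = inj₁ (≈-trans (⊕-cong S≈𝟘 D≈𝟘) (⊕-idˡ 𝟘))

    model-or-zero : ∀ b φ → (∃Compatible λ 𝔄 → 𝔄 ⊨⟨ b ⟩ φ [ noVars V n ])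
                          ⊎ (evalNNF V n π (nnfP V n b φ) (noVars V n) ≈ 𝟘)
    model-or-zero b φ with poly-dichotomy (dnf (nnfP V n b φ) (noVars V n))
    ... | inj₁ D≈𝟘 = inj₂ (≈-trans (dnf-poly π (nnfP V n b φ) (noVars V n)) D≈𝟘)
    ... | inj₂ (𝔄 , c , s) =
      inj₁ (𝔄 , c , from-nnf 𝔄 b φ (noVars V n) (dnf-sound 𝔄 (nnfP V n b φ) (noVars V n) s))

corollary3 : (V : Vocab) (n : ℕ) {X : Set} (π : Lit V n → Poly X) →
    ModelCompatible V n π → (φ : Sentence V n) →
    (ModSatisfiable V n π φ ⇔ (¬ (⟦_⟧ˢ_ V n φ π ≈ 𝟘)))
    × (ModValid V n π φ ⇔ (⟦_⟧ˢ_ V n (¬' φ) π ≈ 𝟘))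
corollary3 V n π mc φ = mk⇔ satisfiable⇒nonzero nonzero⇒satisfiable , mk⇔ valid⇒zero zero⇒valid
  where
  satisfiable⇒nonzero : ModSatisfiable V n π φ → ¬ ⟦_⟧ˢ_ V n φ π ≈ 𝟘
  satisfiable⇒nonzero (𝔄 , c , s) = model⇒nonzero V n mc c true φ s

  nonzero⇒satisfiable : ¬ ⟦_⟧ˢ_ V n φ π ≈ 𝟘 → ModSatisfiable V n π φ
  nonzero⇒satisfiable φ≉𝟘 with model-or-zero V n mc true φ
  ... | inj₁ model = model
  ... | inj₂ φ≈𝟘 = ⊥-elim (φ≉𝟘 φ≈𝟘)

  valid⇒zero : ModValid V n π φ → ⟦_⟧ˢ_ V n (¬' φ) π ≈ 𝟘
  valid⇒zero valid with model-or-zero V n mc false φ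
  ... | inj₁ (𝔄 , c , ¬s) = ⊥-elim (¬s (valid 𝔄 c))
  ... | inj₂ ¬φ≈𝟘 = ¬φ≈𝟘

  -- by decidability, a compatible 𝔄 failing φ would make π⟦¬φ⟧ nonzero
  zero⇒valid : ⟦_⟧ˢ_ V n (¬' φ) π ≈ 𝟘 → ModValid V n π φ
  zero⇒valid ¬φ≈𝟘 𝔄 c =
    decidable-stable (sat? V n 𝔄 φ (noVars V n)) λ ¬s → model⇒nonzero V n mc c false φ ¬s ¬φ≈𝟘
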